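{- Let $G$ be a finite graph and let $A,B\subseteq V(G)$ be two disjoint nonempty vertex subsets, and let $D=V(G)\setminus(A\cup B)$. Suppose that (i) $D$ is an independent set in $G$, (ii) every vertex of $D$ has degree at least $3$ in $G$, and (iii) every cycle of $G$ contains at least one vertex of $A$ and at least one vertex of $B$. Then $|V(G)|\le 2(|A|+|B|)$. -}

module Defs where

open import Data.Nat using (ℕ; zero; suc; _+_; _≤_)
open import Data.Bool using (Bool; true; false; if_then_else_)
open import Data.Fin using (Fin; zero; suc; inject₁; fromℕ)
open import Data.Fin.Subset using (Subset; _∈_; _∉_)
open import Data.List using (map; allFin)
open import Data.Nat.ListAction using (sum)
open import Data.Product using (_×_; ∃; ∃-syntax)
open import Function.Definitions using (Injective)
open import Relation.Binary.PropositionalEquality using (_≡_)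

record Graph (n : ℕ) : Set where
  field
    adj   : Fin n → Fin n → Bool
    sym   : ∀ u v → adj u v ≡ adj v u
    irrefl : ∀ v → adj v v ≡ false
open Graph public

Adj : ∀ {n} → Graph n → Fin n → Fin n → Set
Adj G u v = adj G u v ≡ true

degree : ∀ {n} → Graph n → Fin n → ℕ
degree {n} G v = sum (map (λ w → if adj G v w then 1 else 0) (allFin n))

record Cycle {n : ℕ} (G : Graph n) : Set where
  field
    len₋₃   : ℕ
    vert    : Fin (3 + len₋₃) → Fin n
    distinct : Injective _≡_ _≡_ vert
    step    : ∀ (i : Fin (2 + len₋₃)) → Adj G (vert (inject₁ i)) (vert (suc i))
    close   : Adj G (vert (fromℕ (2 + len₋₃))) (vert zero)
open Cycle public

Meets : ∀ {n} {G : Graph n} → Cycle G → Subset n → Set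
Meets C S = ∃[ i ] (vert C i ∈ S)

-- As D is independent and its vertices have
-- degree at least 3, counting the edges at D gives 3|D| ≤ e(D,A) + e(D,B). A cycle
-- using only edges between D and A would avoid B, so these edges form a forest on
-- |D| + |A| vertices and e(D,A) ≤ |D| + |A|; likewise e(D,B) ≤ |D| + |B|. Hence
-- |D| ≤ |A| + |B|, and |V| = |A| + |B| + |D| ≤ 2(|A| + |B|).
-- The forest bound follows by repeatedly deleting a vertex of degree at most 1,
-- which exists since in a graph of minimum degree 2 a longest path closes a cycle.

module Submission where

open import Defs
open import Data.Nat.Properties hiding (_≟_)
open import Algebra.Properties.Semiring.Sum +-*-semiring
  using (sum; sum-syntax; sum-cong-≗; sum-replicate-zero; ∑-distrib-+; ∑-comm; *-distribˡ-sum)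
open import Data.Bool using (Bool; true; false; not; _∧_; _∨_; if_then_else_)
open import Data.Bool.Properties using (∧-conicalˡ; ∧-conicalʳ; ∧-comm; ∧-zeroʳ; ∧-inverseʳ; ∨-comm; ∨-inverseʳ; ¬-not)
  renaming (_≟_ to _≟ᵇ_)
open import Data.Fin using (Fin; zero; suc; toℕ; fromℕ; inject₁; inject≤)
open import Data.Fin.Subset using (Subset; _∈_; _∉_; Nonempty; ∣_∣)
open import Data.Vec using ([]; _∷_; lookup)
open import Data.Vec.Properties using ([]=⇒lookup; lookup⇒[]=)
open import Data.Fin.Relation.Unary.Top using (view; ‵fromℕ; ‵inject₁)
open import Data.Fin.Properties using (_≟_; any?; injective⇒≤; inject≤-injective; toℕ<n)
open import Data.Nat using (ℕ; zero; suc; _+_; _*_; _≤_; _<_; z≤n; s≤s; s≤s⁻¹; _≤?_)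
open import Data.Product using (_×_; _,_; proj₁; proj₂; ∃-syntax)
open import Data.Sum using (_⊎_; inj₁; inj₂)
open import Data.List using () renaming (map to mapᴸ; tabulate to tabulateᴸ)
open import Data.Nat.Tactic.RingSolver using (solve-∀)
open import Data.Nat.ListAction using () renaming (sum to sumᴸ)
open import Function using (_∘_)
open import Function.Definitions using (Injective)
open import Relation.Nullary using (¬_; yes; no; does; ¬?; contradiction)
open import Relation.Nullary.Decidable using (_×-dec_)
open import Relation.Binary.PropositionalEquality
  using (_≡_; _≢_; refl; trans; cong; cong₂; subst; subst₂; module ≡-Reasoning)
  renaming (sym to ≡-sym)

-- Finite sums and counting

𝟙 : Bool → ℕ
𝟙 b = if b then 1 else 0

count : ∀ {n} → (Fin n → Bool) → ℕ
count {n} P = ∑[ v < n ] 𝟙 (P v)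

∑-mono-≤ : ∀ {n} {f g : Fin n → ℕ} → (∀ i → f i ≤ g i) → sum f ≤ sum g
∑-mono-≤ {zero}  f≤g = z≤n
∑-mono-≤ {suc n} f≤g = +-mono-≤ (f≤g zero) (∑-mono-≤ (f≤g ∘ suc))

∑-zero : ∀ {n} {f : Fin n → ℕ} → (∀ i → f i ≡ 0) → sum f ≡ 0
∑-zero {n} f≡0 = trans (sum-cong-≗ f≡0) (sum-replicate-zero n)

∑-pick : ∀ {n} (x : Fin n) (f : Fin n → ℕ) → ∑[ v < n ] (if does (v ≟ x) then f v else 0) ≡ f x
∑-pick {suc n} zero f = trans (cong (f zero +_) (∑-zero {n} (λ _ → refl))) (+-identityʳ (f zero))
∑-pick {suc n} (suc x) f = ∑-pick x (f ∘ suc)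

count≤1 : ∀ {n} (P : Fin n → Bool) (u : Fin n) → (∀ w → P w ≡ true → w ≡ u) → count P ≤ 1
count≤1 {n} P u only-u = begin
  count P                                        ≤⟨ ∑-mono-≤ bound ⟩
  ∑[ w < n ] (if does (w ≟ u) then 1 else 0)    ≡⟨ ∑-pick u (λ _ → 1) ⟩
  1                                              ∎
  where
  open ≤-Reasoning
  bound : ∀ w → 𝟙 (P w) ≤ (if does (w ≟ u) then 1 else 0)
  bound w with w ≟ u | P w in Pw
  ... | yes _  | true  = ≤-refl
  ... | yes _  | false = z≤n
  ... | no w≢u | true  = contradiction (only-u w Pw) w≢u
  ... | no _   | false = z≤n

count≥2⇒∃≢ : ∀ {n} (P : Fin n → Bool) → 2 ≤ count P → ∀ u → ∃[ w ] w ≢ u × P w ≡ true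
count≥2⇒∃≢ P 2≤count u with any? (λ w → ¬? (w ≟ u) ×-dec (P w ≟ᵇ true))
... | yes found = found
... | no none   = contradiction (count≤1 P u only-u) (<⇒≱ 2≤count)
  where
  only-u : ∀ w → P w ≡ true → w ≡ u
  only-u w Pw with w ≟ u
  ... | yes w≡u = w≡u
  ... | no w≢u  = contradiction (w , w≢u , Pw) none

count-∨ : ∀ {n} (P Q : Fin n → Bool) → (∀ v → P v ∧ Q v ≡ false) →
          count (λ v → P v ∨ Q v) ≡ count P + count Q
count-∨ P Q disjoint = trans (sum-cong-≗ pointwise) (∑-distrib-+ (𝟙 ∘ P) (𝟙 ∘ Q))
  where
  pointwise : ∀ v → 𝟙 (P v ∨ Q v) ≡ 𝟙 (P v) + 𝟙 (Q v)
  pointwise v with P v | Q v | disjoint v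
  ... | true  | false | _ = refl
  ... | false | true  | _ = refl
  ... | false | false | _ = refl

_─_ : ∀ {n} → (Fin n → Bool) → Fin n → Fin n → Bool
(S ─ x) v = if does (v ≟ x) then false else S v

count-─ : ∀ {n} (S : Fin n → Bool) {x} → S x ≡ true → count S ≡ suc (count (S ─ x))
count-─ {n} S {x} Sx = begin
  count S                                                             ≡⟨ sum-cong-≗ pointwise ⟩
  ∑[ v < n ] ((if does (v ≟ x) then 1 else 0) + 𝟙 ((S ─ x) v))      ≡⟨ ∑-distrib-+ {n} _ _ ⟩
  ∑[ v < n ] (if does (v ≟ x) then 1 else 0) + count (S ─ x)        ≡⟨ cong (_+ count (S ─ x)) (∑-pick x _) ⟩
  suc (count (S ─ x))                                                 ∎
  where
  open ≡-Reasoning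
  pointwise : ∀ v → 𝟙 (S v) ≡ (if does (v ≟ x) then 1 else 0) + 𝟙 ((S ─ x) v)
  pointwise v with v ≟ x
  ... | yes refl rewrite Sx = refl
  ... | no _    = refl

∑∑-distrib-+ : ∀ {m n} (f g : Fin m → Fin n → ℕ) →
               ∑[ v < m ] ∑[ w < n ] (f v w + g v w) ≡ ∑[ v < m ] ∑[ w < n ] f v w + ∑[ v < m ] ∑[ w < n ] g v w
∑∑-distrib-+ {m} f g = trans (sum-cong-≗ (λ v → ∑-distrib-+ (f v) (g v))) (∑-distrib-+ {m} _ _)

module _ {n} (H : Graph n) where

  Adj-sym : ∀ {u v} → Adj H u v → Adj H v u
  Adj-sym {u} {v} u~v = trans (sym H v u) u~v

  Adj-irrefl : ∀ {v} → ¬ Adj H v v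
  Adj-irrefl {v} v~v with () ← trans (≡-sym (irrefl H v)) v~v

  degreeIn : (Fin n → Bool) → Fin n → ℕ
  degreeIn S v = count (λ w → S w ∧ adj H v w)

  -- Ordered pairs: an edge with both ends in S is counted twice by edges H S S.
  edges : (Fin n → Bool) → (Fin n → Bool) → ℕ
  edges P Q = ∑[ v < n ] ∑[ w < n ] 𝟙 (P v ∧ Q w ∧ adj H v w)

  edges-sym : ∀ P Q → edges P Q ≡ edges Q P
  edges-sym P Q = trans (∑-comm {n} {n} _) (sum-cong-≗ (λ v → sum-cong-≗ (λ w → cong 𝟙 (swap v w))))
    where
    swap : ∀ v w → P w ∧ Q v ∧ adj H w v ≡ Q v ∧ P w ∧ adj H v w
    swap v w rewrite sym H w v with P w | Q v
    ... | true  | _     = refl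
    ... | false | true  = refl
    ... | false | false = refl

  edges-─ : ∀ S {x} → S x ≡ true → edges S S ≤ degreeIn S x + degreeIn S x + edges (S ─ x) (S ─ x)
  edges-─ S {x} Sx = begin
    edges S S                                                    ≤⟨ ∑-mono-≤ (λ v → ∑-mono-≤ (pointwise v)) ⟩
    ∑[ v < n ] ∑[ w < n ] (δ v (x~ w) + δ w (x~ v) + pair₋ₓ v w) ≡⟨ ∑∑-distrib-+ {n} {n} _ pair₋ₓ ⟩
    ∑[ v < n ] ∑[ w < n ] (δ v (x~ w) + δ w (x~ v)) + edges₋ₓ    ≡⟨ cong (_+ edges₋ₓ) (∑∑-distrib-+ {n} {n} _ _) ⟩
    ∑[ v < n ] ∑[ w < n ] δ v (x~ w) + ∑[ v < n ] ∑[ w < n ] δ w (x~ v) + edges₋ₓ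
      ≡⟨ cong₂ (λ a b → a + b + edges₋ₓ) (trans (∑-comm {n} {n} _) (sum-cong-≗ (λ w → ∑-pick x (λ _ → x~ w))))
                                          (sum-cong-≗ (λ v → ∑-pick x (λ _ → x~ v))) ⟩
    degreeIn S x + degreeIn S x + edges₋ₓ                        ∎
    where
    open ≤-Reasoning
    δ : Fin n → ℕ → ℕ
    δ v m = if does (v ≟ x) then m else 0
    x~ : Fin n → ℕ
    x~ u = 𝟙 (S u ∧ adj H x u)
    pair₋ₓ : Fin n → Fin n → ℕ
    pair₋ₓ v w = 𝟙 ((S ─ x) v ∧ (S ─ x) w ∧ adj H v w)
    edges₋ₓ : ℕ
    edges₋ₓ = edges (S ─ x) (S ─ x)
    pointwise : ∀ v w → 𝟙 (S v ∧ S w ∧ adj H v w) ≤ δ v (x~ w) + δ w (x~ v) + pair₋ₓ v w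
    pointwise v w with v ≟ x | w ≟ x
    ... | yes refl | _        rewrite Sx             = ≤-trans (m≤m+n (x~ w) _) (m≤m+n _ _)
    ... | no _     | yes refl rewrite Sx | sym H v x = m≤m+n (x~ v) _
    ... | no _     | no _                            = ≤-refl

-- Paths and the cycles they close

inject₁-inject≤ : ∀ {m n} (i : Fin m) .(m≤n : m ≤ n) → inject₁ (inject≤ i m≤n) ≡ inject≤ (inject₁ i) (s≤s m≤n)
inject₁-inject≤ {n = suc _} zero    _   = refl
inject₁-inject≤ {n = suc _} (suc i) m≤n = cong suc (inject₁-inject≤ i (s≤s⁻¹ m≤n))

inject≤-fromℕ-toℕ : ∀ {n} (i : Fin n) .(le : suc (toℕ i) ≤ n) → inject≤ (fromℕ (toℕ i)) le ≡ i
inject≤-fromℕ-toℕ zero    _  = refl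
inject≤-fromℕ-toℕ (suc i) le = cong suc (inject≤-fromℕ-toℕ i (s≤s⁻¹ le))

-- The successor of the head on a path with an edge; a new neighbour of the head
-- has to avoid it.
second : ∀ {ℓ} → Fin (suc ℓ)
second {zero}  = zero
second {suc ℓ} = suc zero

record Path {n} (H : Graph n) (ℓ : ℕ) : Set where
  field
    vert     : Fin (suc ℓ) → Fin n
    distinct : Injective _≡_ _≡_ vert
    step     : ∀ (i : Fin ℓ) → Adj H (vert (inject₁ i)) (vert (suc i))
open Path

module _ {n} {H : Graph n} where

  path-length< : ∀ {ℓ} → Path H ℓ → ℓ < n
  path-length< P = injective⇒≤ (distinct P)

  trivialPath : Fin n → Path H 0
  trivialPath x = record { vert = λ _ → x ; distinct = λ { {zero} {zero} _ → refl } ; step = λ () }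

  prepend : ∀ {ℓ} w (P : Path H ℓ) → (∀ i → vert P i ≢ w) → Adj H w (vert P zero) → Path H (suc ℓ)
  prepend w P w∉P w~head = record { vert = vert′ ; distinct = distinct′ ; step = step′ }
    where
    vert′ : Fin _ → Fin n
    vert′ zero    = w
    vert′ (suc i) = vert P i
    distinct′ : Injective _≡_ _≡_ vert′
    distinct′ {zero}  {zero}  _  = refl
    distinct′ {zero}  {suc j} eq = contradiction (≡-sym eq) (w∉P j)
    distinct′ {suc i} {zero}  eq = contradiction eq (w∉P i)
    distinct′ {suc i} {suc j} eq = cong suc (distinct P eq)
    step′ : ∀ i → Adj H (vert′ (inject₁ i)) (vert′ (suc i))
    step′ zero    = w~head
    step′ (suc i) = step P i

  take : ∀ {ℓ} → Path H ℓ → ∀ m → m ≤ ℓ → Path H m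
  take P m m≤ℓ = record
    { vert     = λ i → vert P (inject≤ i (s≤s m≤ℓ))
    ; distinct = λ eq → inject≤-injective _ _ _ _ (distinct P eq)
    ; step     = λ i → subst (λ j → Adj H (vert P j) (vert P (suc (inject≤ i m≤ℓ))))
                             (inject₁-inject≤ i m≤ℓ) (step P (inject≤ i m≤ℓ))
    }

  toCycle : ∀ {k} (P : Path H (2 + k)) → Adj H (vert P (fromℕ (2 + k))) (vert P zero) → Cycle H
  toCycle P last~first = record
    { len₋₃ = _ ; vert = vert P ; distinct = distinct P ; step = step P ; close = last~first }

  chord⇒cycle : ∀ {ℓ} (P : Path H ℓ) j → Adj H (vert P zero) (vert P j) → vert P j ≢ vert P second → Cycle H
  chord⇒cycle P zero          head~head _        = contradiction head~head (Adj-irrefl H)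
  chord⇒cycle P (suc zero)    _         j≢second = contradiction refl j≢second
  chord⇒cycle P (suc (suc k)) head~j    _        =
    toCycle (take P (2 + toℕ k) (s≤s (toℕ<n k)))
            (subst (λ j → Adj H (vert P j) (vert P zero))
                   (≡-sym (inject≤-fromℕ-toℕ (suc (suc k)) (toℕ<n (suc (suc k))))) (Adj-sym H head~j))

module _ {n} {H : Graph n} (S : Fin n → Bool) (deg≥2 : ∀ v → S v ≡ true → 2 ≤ degreeIn H S v) where

  -- Grow the path at its head by an S-neighbour other than `second`. If that
  -- neighbour is already on the path it closes a cycle; the fuel cannot run out,
  -- because a path has fewer than n edges.
  extend : ∀ fuel {ℓ} → n ≤ fuel + ℓ → (P : Path H ℓ) → S (vert P zero) ≡ true → Cycle H
  extend zero       n≤ℓ   P _       = contradiction n≤ℓ (<⇒≱ (path-length< P))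
  extend (suc fuel) {ℓ} n≤fuel+ℓ P head∈S
    with count≥2⇒∃≢ _ (deg≥2 _ head∈S) (vert P second)
  ... | w , w≢second , w∈S∧head~w with any? (λ j → vert P j ≟ w)
  ...   | yes (j , refl) = chord⇒cycle P j (∧-conicalʳ _ _ w∈S∧head~w) w≢second
  ...   | no w∉P = extend fuel (subst (n ≤_) (≡-sym (+-suc fuel ℓ)) n≤fuel+ℓ)
                     (prepend w P (λ i Pi≡w → w∉P (i , Pi≡w)) (Adj-sym H (∧-conicalʳ _ _ w∈S∧head~w)))
                     (∧-conicalˡ _ _ w∈S∧head~w)

  minDegree≥2⇒cycle : ∀ x → S x ≡ true → Cycle H
  minDegree≥2⇒cycle x x∈S = extend n (m≤m+n n 0) (trivialPath x) x∈S

-- Forests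

module _ {n} {H : Graph n} (acyclic : ¬ Cycle H) where

  emptyOrLeaf : ∀ S → (∀ v → S v ≡ false) ⊎ ∃[ v ] S v ≡ true × degreeIn H S v ≤ 1
  emptyOrLeaf S with any? (λ v → S v ≟ᵇ true)
  ... | no noVertex = inj₁ (λ v → ¬-not (λ v∈S → noVertex (v , v∈S)))
  ... | yes (x , x∈S) with any? (λ v → (S v ≟ᵇ true) ×-dec (degreeIn H S v ≤? 1))
  ...   | yes leaf   = inj₂ leaf
  ...   | no noLeaf  = contradiction (minDegree≥2⇒cycle S deg≥2 x x∈S) acyclic
    where
    deg≥2 : ∀ v → S v ≡ true → 2 ≤ degreeIn H S v
    deg≥2 v v∈S = ≰⇒> (λ deg≤1 → noLeaf (v , v∈S , deg≤1))

  edges≤2*count : ∀ S → edges H S S ≤ 2 * count S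
  edges≤2*count S = go (count S) S refl
    where
    go : ∀ k S → count S ≡ k → edges H S S ≤ 2 * count S
    go k S count≡k with emptyOrLeaf S
    ... | inj₁ empty = subst (_≤ 2 * count S) (≡-sym edges≡0) z≤n
      where
      edges≡0 : edges H S S ≡ 0
      edges≡0 = ∑-zero {n} (λ v → ∑-zero {n} (λ w → cong (λ b → 𝟙 (b ∧ S w ∧ adj H v w)) (empty v)))
    go zero    S count≡0 | inj₂ (x , x∈S , _) = contradiction (trans (≡-sym (count-─ S x∈S)) count≡0) λ ()
    go (suc k) S count≡k | inj₂ (x , x∈S , deg≤1) = begin
      edges H S S                                             ≤⟨ edges-─ H S x∈S ⟩
      degreeIn H S x + degreeIn H S x + edges H (S ─ x) (S ─ x) ≤⟨ +-mono-≤ (+-mono-≤ deg≤1 deg≤1) (go k (S ─ x) count-1≡k) ⟩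
      2 + 2 * count (S ─ x)                                   ≡⟨ *-suc 2 (count (S ─ x)) ⟨
      2 * suc (count (S ─ x))                                 ≡⟨ cong (2 *_) (count-─ S x∈S) ⟨
      2 * count S                                             ∎
      where
      open ≤-Reasoning
      count-1≡k : count (S ─ x) ≡ k
      count-1≡k = suc-injective (trans (≡-sym (count-─ S x∈S)) count≡k)

-- Edges between two disjoint sets

cycle-neighbour : ∀ {n} {H : Graph n} (C : Cycle H) i → ∃[ j ] Adj H (vert C i) (vert C j)
cycle-neighbour C i with view i
... | ‵fromℕ     = zero , close C
... | ‵inject₁ j = suc j , step C j

cycle-⊆ : ∀ {n} {H G : Graph n} → (∀ {u v} → Adj H u v → Adj G u v) → Cycle H → Cycle G
cycle-⊆ H⊆G C = record
  { len₋₃ = len₋₃ C ; vert = vert C ; distinct = distinct C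
  ; step = λ i → H⊆G (step C i) ; close = H⊆G (close C) }

module _ {n} (G : Graph n) (P Q : Fin n → Bool) where

  crossing : Fin n → Fin n → Bool
  crossing u v = P u ∧ Q v ∨ Q u ∧ P v

  crossing-sym : ∀ u v → crossing u v ≡ crossing v u
  crossing-sym u v = trans (∨-comm (P u ∧ Q v) _) (cong₂ _∨_ (∧-comm (Q u) (P v)) (∧-comm (P u) (Q v)))

  crossing⇒∈ : ∀ {u v} → crossing u v ≡ true → P u ∨ Q u ≡ true
  crossing⇒∈ {u} {v} cross with P u | Q u
  ... | true  | _    = refl
  ... | false | true = refl

  between : Graph n
  between = record
    { adj    = λ u v → crossing u v ∧ adj G u v
    ; sym    = λ u v → cong₂ _∧_ (crossing-sym u v) (sym G u v)
    ; irrefl = λ v → trans (cong (crossing v v ∧_) (irrefl G v)) (∧-zeroʳ _)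
    }

  between-acyclic : (∀ (C : Cycle G) → ∃[ i ] P (vert C i) ∨ Q (vert C i) ≡ false) → ¬ Cycle between
  between-acyclic leaves C
    with i , i∉P∪Q ← leaves (cycle-⊆ (λ {u} {v} → ∧-conicalʳ (crossing u v) _) C)
    with j , i~j ← cycle-neighbour C i
    = contradiction (trans (≡-sym i∉P∪Q) (crossing⇒∈ (∧-conicalˡ _ _ i~j))) λ ()

  edges-between : (∀ v → P v ∧ Q v ≡ false) →
                  edges between (λ v → P v ∨ Q v) (λ v → P v ∨ Q v) ≡ edges G P Q + edges G Q P
  edges-between disjoint = trans (sum-cong-≗ (λ v → sum-cong-≗ (pointwise v))) (∑∑-distrib-+ {n} {n} _ _)
    where
    pointwise : ∀ v w → 𝟙 ((P v ∨ Q v) ∧ (P w ∨ Q w) ∧ crossing v w ∧ adj G v w)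
                      ≡ 𝟙 (P v ∧ Q w ∧ adj G v w) + 𝟙 (Q v ∧ P w ∧ adj G v w)
    pointwise v w with P v | Q v | P w | Q w | disjoint v | disjoint w
    ... | true  | false | true  | false | _ | _ = refl
    ... | true  | false | false | true  | _ | _ = ≡-sym (+-identityʳ _)
    ... | true  | false | false | false | _ | _ = refl
    ... | false | true  | true  | false | _ | _ = refl
    ... | false | true  | false | true  | _ | _ = refl
    ... | false | true  | false | false | _ | _ = refl
    ... | false | false | _     | _     | _ | _ = refl

  edges≤count+count : (∀ v → P v ∧ Q v ≡ false) →
                      (∀ (C : Cycle G) → ∃[ i ] P (vert C i) ∨ Q (vert C i) ≡ false) →
                      edges G P Q ≤ count P + count Q
  edges≤count+count disjoint leaves = *-cancelˡ-≤ 2 (begin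
    2 * edges G P Q                                   ≡⟨ cong (edges G P Q +_) (trans (+-identityʳ _) (edges-sym G P Q)) ⟩
    edges G P Q + edges G Q P                         ≡⟨ edges-between disjoint ⟨
    edges between (λ v → P v ∨ Q v) (λ v → P v ∨ Q v) ≤⟨ edges≤2*count (between-acyclic leaves) _ ⟩
    2 * count (λ v → P v ∨ Q v)                       ≡⟨ cong (2 *_) (count-∨ P Q disjoint) ⟩
    2 * (count P + count Q)                           ∎)
    where open ≤-Reasoning

sumᴸ-map-tabulate : ∀ {n} {A : Set} (f : A → ℕ) (g : Fin n → A) → sumᴸ (mapᴸ f (tabulateᴸ g)) ≡ ∑[ i < n ] f (g i)
sumᴸ-map-tabulate {zero}  f g = refl
sumᴸ-map-tabulate {suc n} f g = cong (f (g zero) +_) (sumᴸ-map-tabulate f (g ∘ suc))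

module _ {n} (G : Graph n) where

  degree≡count : ∀ v → degree G v ≡ count (adj G v)
  degree≡count v = sumᴸ-map-tabulate (𝟙 ∘ adj G v) (λ w → w)

  degree≡degreeIn+degreeIn : ∀ P Q v → (∀ w → P w ∧ Q w ≡ false) → (∀ w → Adj G v w → P w ∨ Q w ≡ true) →
                             degree G v ≡ degreeIn G P v + degreeIn G Q v
  degree≡degreeIn+degreeIn P Q v disjoint neighbours⊆P∪Q =
    trans (degree≡count v) (trans (sum-cong-≗ pointwise) (∑-distrib-+ {n} _ _))
    where
    pointwise : ∀ w → 𝟙 (adj G v w) ≡ 𝟙 (P w ∧ adj G v w) + 𝟙 (Q w ∧ adj G v w)
    pointwise w with P w in Pw | Q w in Qw | disjoint w | adj G v w in v~w
    ... | true  | false | _ | _     = ≡-sym (+-identityʳ _)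
    ... | false | true  | _ | _     = refl
    ... | false | false | _ | false = refl
    ... | false | false | _ | true  = contradiction (trans (≡-sym (cong₂ _∨_ Pw Qw)) (neighbours⊆P∪Q w v~w)) λ ()

-- The partition into A, B and D

count-lookup : ∀ {n} (A : Subset n) → count (lookup A) ≡ ∣ A ∣
count-lookup []          = refl
count-lookup (true ∷ A)  = cong suc (count-lookup A)
count-lookup (false ∷ A) = count-lookup A

count-const-true : ∀ n → count {n} (λ _ → true) ≡ n
count-const-true zero    = refl
count-const-true (suc n) = cong suc (count-const-true n)

lookup≡false⇒∉ : ∀ {n} (A : Subset n) {v} → lookup A v ≡ false → v ∉ A
lookup≡false⇒∉ A A[v]≡false v∈A with () ← trans (≡-sym ([]=⇒lookup v∈A)) A[v]≡false

3*d≤[d+a]+[d+b]⇒d≤a+b : ∀ d a b → 3 * d ≤ (d + a) + (d + b) → d ≤ a + b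
3*d≤[d+a]+[d+b]⇒d≤a+b d a b le = +-cancelˡ-≤ (d + d) d (a + b) (subst₂ _≤_ (lhs d) (rhs d a b) le)
  where
  lhs : ∀ d → 3 * d ≡ d + d + d
  lhs = solve-∀
  rhs : ∀ d a b → (d + a) + (d + b) ≡ d + d + (a + b)
  rhs = solve-∀

module Partition {n} (G : Graph n) (A B : Subset n) (A∩B≡∅ : ∀ v → v ∈ A → v ∉ B) where

  inA inB inD : Fin n → Bool
  inA = lookup A
  inB = lookup B
  inD v = not (inA v ∨ inB v)

  A∩B≡false : ∀ v → inA v ∧ inB v ≡ false
  A∩B≡false v with inA v in A[v]
  ... | true  = ¬-not (λ B[v] → A∩B≡∅ v (lookup⇒[]= v A A[v]) (lookup⇒[]= v B B[v]))
  ... | false = refl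

  D∩A≡false : ∀ v → inD v ∧ inA v ≡ false
  D∩A≡false v with inA v | inB v
  ... | true  | _     = refl
  ... | false | true  = refl
  ... | false | false = refl

  D∩B≡false : ∀ v → inD v ∧ inB v ≡ false
  D∩B≡false v with inA v | inB v
  ... | true  | _     = refl
  ... | false | true  = refl
  ... | false | false = refl

  ∈A⇒∉D∪B : ∀ {v} → v ∈ A → inD v ∨ inB v ≡ false
  ∈A⇒∉D∪B {v} v∈A with inA v | inB v | A∩B≡false v | []=⇒lookup v∈A
  ... | true | false | _ | _ = refl

  ∈B⇒∉D∪A : ∀ {v} → v ∈ B → inD v ∨ inA v ≡ false
  ∈B⇒∉D∪A {v} v∈B with inA v | inB v | A∩B≡false v | []=⇒lookup v∈B
  ... | false | true | _ | _ = refl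

  inD⇒∉ : ∀ {v} → inD v ≡ true → v ∉ A × v ∉ B
  inD⇒∉ {v} D[v] with inA v in A[v] | inB v in B[v]
  ... | false | false = lookup≡false⇒∉ A A[v] , lookup≡false⇒∉ B B[v]

  n≡∣A∣+∣B∣+∣D∣ : n ≡ ∣ A ∣ + ∣ B ∣ + count inD
  n≡∣A∣+∣B∣+∣D∣ = begin
    n                                            ≡⟨ count-const-true n ⟨
    count {n} (λ _ → true)                       ≡⟨ sum-cong-≗ {n} (λ v → cong 𝟙 (∨-inverseʳ (inA v ∨ inB v))) ⟨
    count (λ v → (inA v ∨ inB v) ∨ inD v)        ≡⟨ count-∨ _ inD (λ v → ∧-inverseʳ (inA v ∨ inB v)) ⟩
    count (λ v → inA v ∨ inB v) + count inD      ≡⟨ cong (_+ count inD) (count-∨ inA inB A∩B≡false) ⟩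
    count inA + count inB + count inD            ≡⟨ cong (λ k → k + count inD) (cong₂ _+_ (count-lookup A) (count-lookup B)) ⟩
    ∣ A ∣ + ∣ B ∣ + count inD                    ∎
    where open ≡-Reasoning

  module _ (D-independent : ∀ u v → u ∉ A → u ∉ B → v ∉ A → v ∉ B → ¬ Adj G u v)
           (D-degree≥3 : ∀ v → v ∉ A → v ∉ B → 3 ≤ degree G v) where

    D-neighbours⊆A∪B : ∀ {v} → inD v ≡ true → ∀ w → Adj G v w → inA w ∨ inB w ≡ true
    D-neighbours⊆A∪B {v} D[v] w v~w with inA w in A[w] | inB w in B[w]
    ... | true  | _     = refl
    ... | false | true  = refl
    ... | false | false = contradiction v~w
      (D-independent v w (proj₁ (inD⇒∉ D[v])) (proj₂ (inD⇒∉ D[v])) (lookup≡false⇒∉ A A[w]) (lookup≡false⇒∉ B B[w]))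

    3∣D∣≤edges : 3 * count inD ≤ edges G inD inA + edges G inD inB
    3∣D∣≤edges = begin
      3 * count inD                                  ≡⟨ *-distribˡ-sum 3 (𝟙 ∘ inD) ⟩
      ∑[ v < n ] (3 * 𝟙 (inD v))                     ≤⟨ ∑-mono-≤ pointwise ⟩
      ∑[ v < n ] (∑[ w < n ] 𝟙 (inD v ∧ inA w ∧ adj G v w) + ∑[ w < n ] 𝟙 (inD v ∧ inB w ∧ adj G v w))
                                                     ≡⟨ ∑-distrib-+ {n} _ _ ⟩
      edges G inD inA + edges G inD inB              ∎
      where
      open ≤-Reasoning
      pointwise : ∀ v → 3 * 𝟙 (inD v) ≤ ∑[ w < n ] 𝟙 (inD v ∧ inA w ∧ adj G v w) + ∑[ w < n ] 𝟙 (inD v ∧ inB w ∧ adj G v w)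
      pointwise v with inD v in D[v]
      ... | false = z≤n
      ... | true  = begin
        3                                        ≤⟨ D-degree≥3 v (proj₁ (inD⇒∉ D[v])) (proj₂ (inD⇒∉ D[v])) ⟩
        degree G v                               ≡⟨ degree≡degreeIn+degreeIn G inA inB v A∩B≡false (D-neighbours⊆A∪B D[v]) ⟩
        degreeIn G inA v + degreeIn G inB v      ∎

    ∣D∣≤∣A∣+∣B∣ : (∀ (C : Cycle G) → Meets C A × Meets C B) → count inD ≤ ∣ A ∣ + ∣ B ∣
    ∣D∣≤∣A∣+∣B∣ meets = 3*d≤[d+a]+[d+b]⇒d≤a+b (count inD) ∣ A ∣ ∣ B ∣ (begin
      3 * count inD                                     ≤⟨ 3∣D∣≤edges ⟩
      edges G inD inA + edges G inD inB                 ≤⟨ +-mono-≤ (edges≤count+count G inD inA D∩A≡false leavesDA)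
                                                                    (edges≤count+count G inD inB D∩B≡false leavesDB) ⟩
      (count inD + count inA) + (count inD + count inB) ≡⟨ cong₂ (λ a b → (count inD + a) + (count inD + b)) (count-lookup A) (count-lookup B) ⟩
      (count inD + ∣ A ∣) + (count inD + ∣ B ∣)         ∎)
      where
      open ≤-Reasoning
      leavesDA : ∀ (C : Cycle G) → ∃[ i ] inD (vert C i) ∨ inA (vert C i) ≡ false
      leavesDA C with i , i∈B ← proj₂ (meets C) = i , ∈B⇒∉D∪A i∈B
      leavesDB : ∀ (C : Cycle G) → ∃[ i ] inD (vert C i) ∨ inB (vert C i) ≡ false
      leavesDB C with i , i∈A ← proj₁ (meets C) = i , ∈A⇒∉D∪B i∈A

lemma1 : ∀ {n : ℕ} (G : Graph n) (A B : Subset n)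
           → (∀ v → v ∈ A → v ∉ B)
           → Nonempty A → Nonempty B
           → (∀ u v → u ∉ A → u ∉ B → v ∉ A → v ∉ B → ¬ Adj G u v)
           → (∀ v → v ∉ A → v ∉ B → 3 ≤ degree G v)
           → (∀ (C : Cycle G) → Meets C A × Meets C B)
           → n ≤ 2 * (∣ A ∣ + ∣ B ∣)
lemma1 {n} G A B A∩B≡∅ _ _ D-independent D-degree≥3 meets = begin
  n                                     ≡⟨ n≡∣A∣+∣B∣+∣D∣ ⟩
  ∣ A ∣ + ∣ B ∣ + count inD             ≤⟨ +-monoʳ-≤ (∣ A ∣ + ∣ B ∣) (∣D∣≤∣A∣+∣B∣ D-independent D-degree≥3 meets) ⟩
  ∣ A ∣ + ∣ B ∣ + (∣ A ∣ + ∣ B ∣)       ≡⟨ cong (∣ A ∣ + ∣ B ∣ +_) (+-identityʳ _) ⟨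
  2 * (∣ A ∣ + ∣ B ∣)                   ∎
  where
  open ≤-Reasoning
  open Partition G A B A∩B≡∅
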